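{- For $m\ge5$, there is no quasi-symmetric 2-design of defect $\mu\ge2$ whose block graph is the triangular graph $T_m$.
   Context: The triangular graph $T_m$ is the line graph of the complete graph $K_m$: its vertices are the $\binom{m}{2}$ edges of $K_m$, two adjacent iff they share exactly one vertex. A quasi-symmetric 2-design is a 2-design with exactly two block intersection numbers $\lambda_1<\lambda_2$; its defect is $\mu=\lambda_2-\lambda_1$ and its block graph has the blocks as vertices, two blocks adjacent iff they meet in exactly $\lambda_2$ points. -}

module Defs where

open import Data.Nat using (ℕ; _<_)
open import Data.Bool using (_∧_)
open import Data.Fin using (Fin)
open import Data.Fin.Subset using (Subset; ∣_∣; _∩_)
open import Data.Vec using (lookup; tabulate)
open import Data.Product using (_×_; Σ; ∃; ∃-syntax; _,_)
open import Data.Sum using (_⊎_)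
open import Relation.Nullary using (¬_)
open import Relation.Binary.PropositionalEquality using (_≡_)
open import Function.Bundles using (_⇔_)

-- A block family: b blocks on the point set Fin v, each block a subset of Fin v
-- (repeated blocks are allowed in principle, as a list of blocks).
Blocks : ℕ → ℕ → Set
Blocks v b = Fin b → Subset v

blocksThrough : ∀ {v b} → Blocks v b → Fin v → Fin v → Subset b
blocksThrough B x y = tabulate (λ i → lookup (B i) x ∧ lookup (B i) y)

Is2Design : ∀ {v b} → Blocks v b → ℕ → ℕ → Set
Is2Design {v} B k lam =
  (∀ i → ∣ B i ∣ ≡ k) ×
  (∀ (x y : Fin v) → ¬ x ≡ y → ∣ blocksThrough B x y ∣ ≡ lam)

HasIntersectionNumbers : ∀ {v b} → Blocks v b → ℕ → ℕ → Set
HasIntersectionNumbers {v} {b} B l₁ l₂ =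
  l₁ < l₂ ×
  (∀ (i j : Fin b) → ¬ i ≡ j → ∣ B i ∩ B j ∣ ≡ l₁ ⊎ ∣ B i ∩ B j ∣ ≡ l₂) ×
  (∃[ i ] ∃[ j ] (¬ i ≡ j × ∣ B i ∩ B j ∣ ≡ l₁)) ×
  (∃[ i ] ∃[ j ] (¬ i ≡ j × ∣ B i ∩ B j ∣ ≡ l₂))

IsQuasiSymmetric : ∀ {v b} → Blocks v b → ℕ → ℕ → ℕ → ℕ → Set
IsQuasiSymmetric B k lam l₁ l₂ = Is2Design B k lam × HasIntersectionNumbers B l₁ l₂

BlockAdj : ∀ {v b} → Blocks v b → ℕ → Fin b → Fin b → Set
BlockAdj B l₂ i j = ¬ i ≡ j × ∣ B i ∩ B j ∣ ≡ l₂

-- Triangular graph T_m: vertices are the 2-subsets of Fin m (edges of K_m),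
-- adjacent iff they share exactly one element.



TriAdj : ∀ {m} → Subset m → Subset m → Set
TriAdj s t = ∣ s ∩ t ∣ ≡ 1

BlockGraphIsoTriangular : ∀ {v b} → Blocks v b → ℕ → ℕ → Set
BlockGraphIsoTriangular {v} {b} B l₂ m =
  Σ (Fin b → Subset m) λ f →
    (∀ i → ∣ f i ∣ ≡ 2) ×
    (∀ i j → f i ≡ f j → i ≡ j) ×
    (∀ (s : Subset m) → ∣ s ∣ ≡ 2 → ∃[ i ] f i ≡ s) ×
    (∀ i j → (BlockAdj B l₂ i j ⇔ (¬ i ≡ j × TriAdj (f i) (f j))))

-- Label the blocks by the pairs of an m-set. Adjacency in T_m makes the block intersection matrix
-- l₁J + μ·(meet matrix of the pairs) + θ-quad·I, where μ = l₂ - l₁ and θ-quad = k + l₁ - 2l₂. For an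
-- eigenvector w of it with eigenvalue θ and Σw = 0, the lift of w to the points (the blocks weighted by w)
-- satisfies (r - λ - θ)·lift = 0 and ‖lift‖² = θ‖w‖². The star vectors (blocks through a) - (blocks
-- through d) thus give r - λ = θ-star = (m - 2)μ + θ-quad; the quadrangle vectors {pq} + {st} - {ps} - {qt}
-- then force θ-quad = 0, and their lifts vanish: the pairs whose blocks contain a given point obey the
-- quadrangle rule. Such a graph containing ac but not cd is, apart from the edge ad, a star at a or complete
-- away from d. So two of the k - l₂ = μ ≥ 2 points of B_ac outside B_cd are separated by B_ad alone,
-- whereas any two points are separated by r - λ = (m - 2)μ ≥ 2 blocks.

module Submission where

open import Defs
open import Data.Nat using (ℕ; _≤_; _∸_)
open import Data.Product using (_×_)
open import Relation.Nullary using (¬_)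

open import Data.Nat as ℕ using (zero; suc; s≤s; z≤n)
import Data.Nat.Properties as ℕP
open import Data.Integer as ℤ using (ℤ; +_; _+_; _*_; _-_; 0ℤ; 1ℤ; +≤+)
import Data.Integer.Properties as ℤP
open import Data.Integer.Tactic.RingSolver using (solve-∀)
open import Data.Bool using (Bool; true; false; _∧_; _∨_; not)
open import Data.Fin using (Fin; zero; suc)
open import Data.Fin.Patterns using (0F; 1F; 2F; 3F)
open import Data.Fin.Properties using (_≟_; suc-injective; ¬∀⟶∃¬)
open import Data.Fin.Subset using (Subset; ∣_∣; _∩_)
open import Data.Fin.Subset.Properties using (∣p∩q∣≤∣p∣)
open import Data.Vec using ([]; _∷_; lookup; tabulate)
open import Data.Vec.Properties using (lookup-zipWith; lookup∘tabulate; tabulate∘lookup; tabulate-cong)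
open import Data.Product using (Σ; ∃; ∃₂; _,_; proj₁; proj₂)
open import Data.Sum using (_⊎_; inj₁; inj₂)
open import Data.Empty using (⊥-elim)
open import Function using (_∘_)
open import Function.Bundles using (_⇔_; Equivalence)
open import Relation.Nullary using (does; yes; no; recompute)
open import Relation.Binary.PropositionalEquality
open import Algebra.Properties.Semiring.Sum ℤP.+-*-semiring
  using (sum-syntax; sum-cong-≗; ∑-distrib-+; ∑-comm; *-distribˡ-sum; *-distribʳ-sum)

*-cancelʳ-≢0 : ∀ a c {x} → ¬ x ≡ 0ℤ → a * x ≡ c * x → a ≡ c
*-cancelʳ-≢0 a c {x} x≢0 eq with ℤP.i*j≡0⇒i≡0∨j≡0 (a - c) (trans (distrib a c x) (ℤP.i≡j⇒i-j≡0 eq))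
  where
  distrib : ∀ a c x → (a - c) * x ≡ a * x - c * x
  distrib = solve-∀
... | inj₁ a-c≡0 = ℤP.i-j≡0⇒i≡j a c a-c≡0
... | inj₂ x≡0 = ⊥-elim (x≢0 x≡0)

+∸ : ∀ {m n} → n ≤ m → + (m ∸ n) ≡ + m - + n
+∸ {m} {n} n≤m = sym (trans (ℤP.m-n≡m⊖n m n) (ℤP.⊖-≥ n≤m))

𝟙 : Bool → ℤ
𝟙 true = 1ℤ
𝟙 false = 0ℤ

𝟙-∧ : ∀ a c → 𝟙 (a ∧ c) ≡ 𝟙 a * 𝟙 c
𝟙-∧ true c = sym (ℤP.*-identityˡ (𝟙 c))
𝟙-∧ false c = refl

𝟙-idem : ∀ a → 𝟙 a * 𝟙 a ≡ 𝟙 a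
𝟙-idem true = refl
𝟙-idem false = refl

𝟙-nonneg : ∀ a → 0ℤ ℤ.≤ 𝟙 a
𝟙-nonneg true = +≤+ z≤n
𝟙-nonneg false = +≤+ z≤n

𝟙≡1⇒true : ∀ {a} → 𝟙 a ≡ 1ℤ → a ≡ true
𝟙≡1⇒true {true} _ = refl

𝟙≡0⇒false : ∀ {a} → 𝟙 a ≡ 0ℤ → a ≡ false
𝟙≡0⇒false {false} _ = refl

δ : ∀ {n} → Fin n → Fin n → ℤ
δ p q = 𝟙 (does (p ≟ q))

δ-refl : ∀ {n} (p : Fin n) → δ p p ≡ 1ℤ
δ-refl p with p ≟ p
... | yes _ = refl
... | no p≢p = ⊥-elim (p≢p refl)

δ-≢ : ∀ {n} {p q : Fin n} → ¬ p ≡ q → δ p q ≡ 0ℤ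
δ-≢ {p = p} {q} p≢q with p ≟ q
... | yes p≡q = ⊥-elim (p≢q p≡q)
... | no _ = refl

∑-*ˡ : ∀ {n} c (f : Fin n → ℤ) → ∑[ i < n ] (c * f i) ≡ c * ∑[ i < n ] f i
∑-*ˡ c f = sym (*-distribˡ-sum c f)

∑-*ʳ : ∀ {n} c (f : Fin n → ℤ) → ∑[ i < n ] (f i * c) ≡ ∑[ i < n ] f i * c
∑-*ʳ c f = sym (*-distribʳ-sum c f)

∑-distrib-- : ∀ {n} (f g : Fin n → ℤ) → ∑[ i < n ] (f i - g i) ≡ ∑[ i < n ] f i - ∑[ i < n ] g i
∑-distrib-- {zero} f g = refl
∑-distrib-- {suc n} f g =
  trans (cong (λ t → f zero - g zero + t) (∑-distrib-- (f ∘ suc) (g ∘ suc)))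
        (interchange (f zero) (g zero) (∑[ i < n ] f (suc i)) (∑[ i < n ] g (suc i)))
  where
  interchange : ∀ a b c d → a - b + (c - d) ≡ a + c - (b + d)
  interchange = solve-∀

∑-distrib-+-- : ∀ {n} (f g h k : Fin n → ℤ) →
  ∑[ i < n ] (f i + g i - h i - k i) ≡ ∑[ i < n ] f i + ∑[ i < n ] g i - ∑[ i < n ] h i - ∑[ i < n ] k i
∑-distrib-+-- f g h k =
  trans (∑-distrib-- (λ i → f i + g i - h i) k)
        (cong (λ t → t - ∑[ i < _ ] k i)
              (trans (∑-distrib-- (λ i → f i + g i) h) (cong (λ t → t - ∑[ i < _ ] h i) (∑-distrib-+ f g))))

∑-const : ∀ n c → ∑[ i < n ] c ≡ + n * c
∑-const zero c = sym (ℤP.*-zeroˡ c)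
∑-const (suc n) c = trans (cong (λ t → c + t) (∑-const n c)) (step c (+ n))
  where
  step : ∀ c x → c + x * c ≡ (1ℤ + x) * c
  step = solve-∀

∑-supported : ∀ {n} (e : Fin n) (f : Fin n → ℤ) → (∀ j → ¬ e ≡ j → f j ≡ 0ℤ) → ∑[ j < n ] f j ≡ f e
∑-supported {suc n} zero f off =
  trans (cong (λ t → f zero + t) (trans (sum-cong-≗ (λ j → off (suc j) λ ()))
                                         (trans (∑-const n 0ℤ) (ℤP.*-zeroʳ (+ n)))))
        (ℤP.+-identityʳ (f zero))
∑-supported {suc n} (suc e) f off =
  trans (cong (_+ ∑[ j < n ] f (suc j)) (off zero λ ()))
        (trans (ℤP.+-identityˡ _) (∑-supported e (f ∘ suc) (λ j e≢j → off (suc j) (e≢j ∘ suc-injective))))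

∑-δ : ∀ {n} (e : Fin n) (f : Fin n → ℤ) → ∑[ j < n ] (δ e j * f j) ≡ f e
∑-δ e f = trans (∑-supported e (λ j → δ e j * f j) (λ j e≢j → cong (_* f j) (δ-≢ e≢j)))
                (trans (cong (_* f e) (δ-refl e)) (ℤP.*-identityˡ (f e)))

∑-constant-except : ∀ {n} (e : Fin n) (c : ℤ) (f : Fin n → ℤ) → (∀ j → ¬ e ≡ j → f j ≡ c) →
                    ∑[ j < n ] f j ≡ f e - c + + n * c
∑-constant-except {n} e c f off = begin
  ∑[ j < n ] f j                       ≡⟨ sum-cong-≗ (λ j → shift (f j) c) ⟩
  ∑[ j < n ] ((f j - c) + c)           ≡⟨ ∑-distrib-+ (λ j → f j - c) (λ _ → c) ⟩
  ∑[ j < n ] (f j - c) + ∑[ j < n ] c  ≡⟨ cong₂ _+_ (∑-supported e _ (λ j e≢j → ℤP.i≡j⇒i-j≡0 (off j e≢j)))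
                                                   (∑-const n c) ⟩
  f e - c + + n * c                    ∎
  where
  open ≡-Reasoning
  shift : ∀ x c → x ≡ (x - c) + c
  shift = solve-∀

∑-*-∑ : ∀ {n p} (a : Fin n → ℤ) (g : Fin n → Fin p → ℤ) →
        ∑[ i < n ] (a i * ∑[ j < p ] g i j) ≡ ∑[ j < p ] ∑[ i < n ] (a i * g i j)
∑-*-∑ a g = trans (sum-cong-≗ (λ i → *-distribˡ-sum (a i) (g i))) (∑-comm (λ i j → a i * g i j))

∑-mono-≤ : ∀ {n} (f g : Fin n → ℤ) → (∀ i → f i ℤ.≤ g i) → ∑[ i < n ] f i ℤ.≤ ∑[ i < n ] g i
∑-mono-≤ {zero} f g f≤g = ℤP.≤-refl
∑-mono-≤ {suc n} f g f≤g = ℤP.+-mono-≤ (f≤g zero) (∑-mono-≤ (f ∘ suc) (g ∘ suc) (f≤g ∘ suc))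

∑-nonneg : ∀ {n} (f : Fin n → ℤ) → (∀ i → 0ℤ ℤ.≤ f i) → 0ℤ ℤ.≤ ∑[ i < n ] f i
∑-nonneg {n} f f≥0 =
  subst (ℤ._≤ ∑[ i < n ] f i) (trans (∑-const n 0ℤ) (ℤP.*-zeroʳ (+ n))) (∑-mono-≤ (λ _ → 0ℤ) f f≥0)

nonneg-+≡0 : ∀ {a b} → 0ℤ ℤ.≤ a → 0ℤ ℤ.≤ b → a + b ≡ 0ℤ → a ≡ 0ℤ × b ≡ 0ℤ
nonneg-+≡0 {+ m} {+ n} _ _ m+n≡0 =
  cong +_ (ℕP.m+n≡0⇒m≡0 m (ℤP.+-injective m+n≡0)) , cong +_ (ℕP.m+n≡0⇒n≡0 m (ℤP.+-injective m+n≡0))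

∑-nonneg≡0⇒≡0 : ∀ {n} (f : Fin n → ℤ) → (∀ i → 0ℤ ℤ.≤ f i) →
                 ∑[ i < n ] f i ≡ 0ℤ → ∀ i → f i ≡ 0ℤ
∑-nonneg≡0⇒≡0 f f≥0 ∑≡0 zero = proj₁ (nonneg-+≡0 (f≥0 zero) (∑-nonneg (f ∘ suc) (f≥0 ∘ suc)) ∑≡0)
∑-nonneg≡0⇒≡0 f f≥0 ∑≡0 (suc i) =
  ∑-nonneg≡0⇒≡0 (f ∘ suc) (f≥0 ∘ suc) (proj₂ (nonneg-+≡0 (f≥0 zero) (∑-nonneg (f ∘ suc) (f≥0 ∘ suc)) ∑≡0)) i

∑-squares≡0⇒≡0 : ∀ {n} (f : Fin n → ℤ) → ∑[ i < n ] (f i * f i) ≡ 0ℤ → ∀ i → f i ≡ 0ℤ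
∑-squares≡0⇒≡0 f ∑≡0 i
  with ℤP.i*j≡0⇒i≡0∨j≡0 (f i) (∑-nonneg≡0⇒≡0 (λ i → f i * f i) (λ i → square-nonneg (f i)) ∑≡0 i)
  where
  square-nonneg : ∀ x → 0ℤ ℤ.≤ x * x
  square-nonneg (+ n) = subst (0ℤ ℤ.≤_) (ℤP.pos-* n n) (+≤+ z≤n)
  square-nonneg ℤ.-[1+ n ] = +≤+ z≤n
... | inj₁ fi≡0 = fi≡0
... | inj₂ fi≡0 = fi≡0

private
  drop-true : ∀ {c} x → 0ℤ ℤ.≤ x → + suc c ℤ.≤ 1ℤ + x → + c ℤ.≤ x
  drop-true (+ r) _ (+≤+ (s≤s c≤r)) = +≤+ c≤r

  drop-false : ∀ {c} x → + c ℤ.≤ 0ℤ + x → + c ℤ.≤ x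
  drop-false x = subst (_ ℤ.≤_) (ℤP.+-identityˡ x)

count≥1⇒true : ∀ {n} (u : Fin n → Bool) → + 1 ℤ.≤ ∑[ i < n ] 𝟙 (u i) → ∃ λ x → u x ≡ true
count≥1⇒true {zero} u (+≤+ ())
count≥1⇒true {suc n} u h with u zero in u0
... | true = zero , u0
... | false = let x , ux = count≥1⇒true (u ∘ suc) (drop-false _ h) in suc x , ux

count≥2⇒two-trues : ∀ {n} (u : Fin n → Bool) → + 2 ℤ.≤ ∑[ i < n ] 𝟙 (u i) →
                    ∃₂ λ x y → ¬ x ≡ y × u x ≡ true × u y ≡ true
count≥2⇒two-trues {zero} u (+≤+ ())
count≥2⇒two-trues {suc n} u h with u zero in u0
... | true = let y , uy = count≥1⇒true (u ∘ suc) (drop-true _ (∑-nonneg _ (𝟙-nonneg ∘ u ∘ suc)) h)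
             in zero , suc y , (λ ()) , u0 , uy
... | false = let x , y , x≢y , ux , uy = count≥2⇒two-trues (u ∘ suc) (drop-false _ h)
              in suc x , suc y , x≢y ∘ suc-injective , ux , uy

card≡∑ : ∀ {n} (s : Subset n) → + ∣ s ∣ ≡ ∑[ z < n ] 𝟙 (lookup s z)
card≡∑ [] = refl
card≡∑ (true ∷ s) = cong (λ t → 1ℤ + t) (card≡∑ s)
card≡∑ (false ∷ s) = trans (card≡∑ s) (sym (ℤP.+-identityˡ _))

card-∩≡∑ : ∀ {n} (s t : Subset n) → + ∣ s ∩ t ∣ ≡ ∑[ z < n ] (𝟙 (lookup s z) * 𝟙 (lookup t z))
card-∩≡∑ s t = trans (card≡∑ (s ∩ t))
  (sum-cong-≗ λ z → trans (cong 𝟙 (lookup-zipWith _∧_ z s t)) (𝟙-∧ (lookup s z) (lookup t z)))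

pair : ∀ {n} → Fin n → Fin n → Subset n
pair p q = tabulate (λ z → does (p ≟ z) ∨ does (q ≟ z))

𝟙-pair : ∀ {n} {p q : Fin n} → ¬ p ≡ q → ∀ z → 𝟙 (lookup (pair p q) z) ≡ δ p z + δ q z
𝟙-pair {p = p} {q} p≢q z rewrite lookup∘tabulate (λ z → does (p ≟ z) ∨ does (q ≟ z)) z
  with p ≟ z | q ≟ z
... | yes refl | yes refl = ⊥-elim (p≢q refl)
... | yes _    | no _     = refl
... | no _     | yes _    = refl
... | no _     | no _     = refl

pair-card : ∀ {n} {p q : Fin n} → ¬ p ≡ q → ∣ pair p q ∣ ≡ 2
pair-card {n} {p} {q} p≢q = ℤP.+-injective (begin
  + ∣ pair p q ∣                         ≡⟨ card≡∑ (pair p q) ⟩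
  ∑[ z < n ] 𝟙 (lookup (pair p q) z)     ≡⟨ sum-cong-≗ (𝟙-pair p≢q) ⟩
  ∑[ z < n ] (δ p z + δ q z)             ≡⟨ ∑-distrib-+ (δ p) (δ q) ⟩
  ∑[ z < n ] δ p z + ∑[ z < n ] δ q z    ≡⟨ cong₂ _+_ (∑-δ-1 p) (∑-δ-1 q) ⟩
  + 2                                    ∎)
  where
  open ≡-Reasoning
  ∑-δ-1 : ∀ e → ∑[ z < n ] δ e z ≡ 1ℤ
  ∑-δ-1 e = trans (sum-cong-≗ (λ z → sym (ℤP.*-identityʳ (δ e z)))) (∑-δ e (λ _ → 1ℤ))

-- Members of s outside {p, q} contribute nonnegative terms to a total of 2 - 1 - 1 = 0.
two-subset≡pair : ∀ {n} (s : Subset n) {p q : Fin n} → ∣ s ∣ ≡ 2 → ¬ p ≡ q →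
                  lookup s p ≡ true → lookup s q ≡ true → s ≡ pair p q
two-subset≡pair {n} s {p} {q} ∣s∣≡2 p≢q sp sq =
  trans (sym (tabulate∘lookup s)) (tabulate-cong agree)
  where
  open ≡-Reasoning
  excess : Fin n → ℤ
  excess z = 𝟙 (lookup s z) - δ p z * 𝟙 (lookup s z) - δ q z * 𝟙 (lookup s z)

  ∑-excess : ∑[ z < n ] excess z ≡ 0ℤ
  ∑-excess = begin
    ∑[ z < n ] excess z
      ≡⟨ ∑-distrib-- (λ z → 𝟙 (lookup s z) - δ p z * 𝟙 (lookup s z)) (λ z → δ q z * 𝟙 (lookup s z)) ⟩
    ∑[ z < n ] (𝟙 (lookup s z) - δ p z * 𝟙 (lookup s z)) - ∑[ z < n ] (δ q z * 𝟙 (lookup s z))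
      ≡⟨ cong₂ _-_ (∑-distrib-- (λ z → 𝟙 (lookup s z)) (λ z → δ p z * 𝟙 (lookup s z))) (∑-δ q _) ⟩
    ∑[ z < n ] 𝟙 (lookup s z) - ∑[ z < n ] (δ p z * 𝟙 (lookup s z)) - 𝟙 (lookup s q)
      ≡⟨ cong₂ (λ a b → a - b - 𝟙 (lookup s q)) (sym (card≡∑ s)) (∑-δ p _) ⟩
    + ∣ s ∣ - 𝟙 (lookup s p) - 𝟙 (lookup s q)
      ≡⟨ cong₂ (λ a b → + ∣ s ∣ - a - b) (cong 𝟙 sp) (cong 𝟙 sq) ⟩
    + ∣ s ∣ - 1ℤ - 1ℤ
      ≡⟨ cong (λ a → + a - 1ℤ - 1ℤ) ∣s∣≡2 ⟩
    0ℤ ∎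

  excess-nonneg : ∀ z → 0ℤ ℤ.≤ excess z
  excess-nonneg z with p ≟ z | q ≟ z | lookup s z
  ... | yes refl | yes refl | _ = ⊥-elim (p≢q refl)
  ... | yes _ | no _ | true  = +≤+ z≤n
  ... | yes _ | no _ | false = +≤+ z≤n
  ... | no _  | yes _ | true  = +≤+ z≤n
  ... | no _  | yes _ | false = +≤+ z≤n
  ... | no _  | no _ | true  = +≤+ z≤n
  ... | no _  | no _ | false = +≤+ z≤n

  agree : ∀ z → lookup s z ≡ (does (p ≟ z) ∨ does (q ≟ z))
  agree z with ∑-nonneg≡0⇒≡0 excess excess-nonneg ∑-excess z
  ... | excess≡0 with p ≟ z | q ≟ z
  ...   | yes refl | _ = sp
  ...   | no _ | yes refl = sq
  ...   | no _ | no _ = 𝟙≡0⇒false (trans (sym (outside (lookup s z))) excess≡0)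
    where
    outside : ∀ a → 𝟙 a - 0ℤ * 𝟙 a - 0ℤ * 𝟙 a ≡ 𝟙 a
    outside true = refl
    outside false = refl

-- Graphs obeying the quadrangle rule

1≢0 : ¬ 1ℤ ≡ 0ℤ
1≢0 ()

Binary : ℤ → Set
Binary x = x ≡ 0ℤ ⊎ x ≡ 1ℤ

𝟙-binary : ∀ a → Binary (𝟙 a)
𝟙-binary true = inj₂ refl
𝟙-binary false = inj₁ refl

≥2⇒¬binary : ∀ {n} → 2 ≤ n → ¬ Binary (+ n)
≥2⇒¬binary (s≤s (s≤s _)) (inj₁ ())
≥2⇒¬binary (s≤s (s≤s _)) (inj₂ ())

binary-1+ : ∀ {x y} → Binary x → Binary y → x + 0ℤ ≡ 1ℤ + y → x ≡ 1ℤ × y ≡ 0ℤ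
binary-1+ (inj₂ refl) (inj₁ refl) _ = refl , refl
binary-1+ (inj₁ refl) (inj₁ refl) ()
binary-1+ (inj₁ refl) (inj₂ refl) ()
binary-1+ (inj₂ refl) (inj₂ refl) ()

record QuadrangleGraph (n : ℕ) : Set where
  field
    edge : Fin n → Fin n → ℤ
    symmetric : ∀ p q → edge p q ≡ edge q p
    binary : ∀ {p q} → ¬ p ≡ q → Binary (edge p q)
    quadrangle-rule : ∀ {p q s t} → ¬ p ≡ q → ¬ p ≡ s → ¬ p ≡ t → ¬ q ≡ s → ¬ q ≡ t → ¬ s ≡ t →
                      edge p q + edge s t ≡ edge p s + edge q t

module _ {n} {a c d : Fin n} (a≢c : ¬ a ≡ c) (a≢d : ¬ a ≡ d) (c≢d : ¬ c ≡ d) where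

  module _ (G : QuadrangleGraph n) (ac : QuadrangleGraph.edge G a c ≡ 1ℤ) (cd : QuadrangleGraph.edge G c d ≡ 0ℤ) where

    open QuadrangleGraph G

    hub-and-antihub : ∀ {p} → ¬ a ≡ p → ¬ d ≡ p → edge a p ≡ 1ℤ × edge d p ≡ 0ℤ
    hub-and-antihub {p} a≢p d≢p with c ≟ p
    ... | yes refl = ac , trans (symmetric d c) cd
    ... | no c≢p = let ap , pd = binary-1+ (binary a≢p) (binary (d≢p ∘ sym)) a-p-d in ap , trans (symmetric d p) pd
      where
      open ≡-Reasoning
      a-p-d : edge a p + 0ℤ ≡ 1ℤ + edge p d
      a-p-d = begin
        edge a p + 0ℤ         ≡⟨ cong (λ t → edge a p + t) (sym cd) ⟩
        edge a p + edge c d   ≡⟨ quadrangle-rule a≢p a≢c a≢d (c≢p ∘ sym) (d≢p ∘ sym) c≢d ⟩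
        edge a c + edge p d   ≡⟨ cong (_+ edge p d) ac ⟩
        1ℤ + edge p d         ∎

    off-hub : ∀ {p q} → ¬ p ≡ q → ¬ a ≡ p → ¬ a ≡ q → ¬ d ≡ p → ¬ d ≡ q → edge a d + edge p q ≡ 1ℤ
    off-hub {p} {q} p≢q a≢p a≢q d≢p d≢q = begin
      edge a d + edge p q   ≡⟨ quadrangle-rule a≢d a≢p a≢q (d≢p) (d≢q) p≢q ⟩
      edge a p + edge d q   ≡⟨ cong₂ _+_ (proj₁ (hub-and-antihub a≢p d≢p)) (proj₂ (hub-and-antihub a≢q d≢q)) ⟩
      1ℤ                    ∎
      where open ≡-Reasoning

  module _ (G G' : QuadrangleGraph n)
           (ac : QuadrangleGraph.edge G a c ≡ 1ℤ) (cd : QuadrangleGraph.edge G c d ≡ 0ℤ)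
           (ac' : QuadrangleGraph.edge G' a c ≡ 1ℤ) (cd' : QuadrangleGraph.edge G' c d ≡ 0ℤ) where

    private
      module E = QuadrangleGraph G
      module E' = QuadrangleGraph G'

      from-a : ∀ {z} → ¬ a ≡ z → E'.edge a z ≡ 0ℤ → z ≡ d
      from-a {z} a≢z az' with d ≟ z
      ... | yes d≡z = sym d≡z
      ... | no d≢z with () ← trans (sym az') (proj₁ (hub-and-antihub G' ac' cd' a≢z d≢z))

      from-d : ∀ {z} → ¬ d ≡ z → E.edge d z ≡ 1ℤ → z ≡ a
      from-d {z} d≢z dz with a ≟ z
      ... | yes a≡z = sym a≡z
      ... | no a≢z with () ← trans (sym dz) (proj₂ (hub-and-antihub G ac cd a≢z d≢z))

    edge-difference : ¬ (E.edge a d ≡ 0ℤ × E'.edge a d ≡ 1ℤ) →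
      ∀ {p q} → ¬ p ≡ q → E.edge p q ≡ 1ℤ → E'.edge p q ≡ 0ℤ → (p ≡ a × q ≡ d) ⊎ (p ≡ d × q ≡ a)
    edge-difference ordered {p} {q} p≢q pq pq' with a ≟ p | d ≟ p
    ... | yes refl | _        = inj₁ (refl , from-a p≢q pq')
    ... | no _     | yes refl = inj₂ (refl , from-d p≢q pq)
    ... | no a≢p   | no d≢p with a ≟ q | d ≟ q
    ...   | yes refl | _        = inj₂ (from-a a≢p (trans (E'.symmetric a p) pq') , refl)
    ...   | no _     | yes refl = inj₁ (from-d d≢p (trans (E.symmetric d p) pq) , refl)
    ...   | no a≢q   | no d≢q   = ⊥-elim (ordered (lost , gained))
      where
      lost : E.edge a d ≡ 0ℤ
      lost with E.binary a≢d
      ... | inj₁ ad≡0 = ad≡0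
      ... | inj₂ ad≡1 with () ← trans (cong₂ _+_ (sym ad≡1) (sym pq)) (off-hub G ac cd p≢q a≢p a≢q d≢p d≢q)
      gained : E'.edge a d ≡ 1ℤ
      gained = trans (sym (ℤP.+-identityʳ _))
                     (trans (cong (λ t → E'.edge a d + t) (sym pq')) (off-hub G' ac' cd' p≢q a≢p a≢q d≢p d≢q))

-- The incidence algebra of a 2-design

module TwoDesign {v b} (B : Blocks v b) (k lam : ℕ) (design : Is2Design B k lam) where

  open ≡-Reasoning

  χ : Fin b → Fin v → ℤ
  χ i x = 𝟙 (lookup (B i) x)

  K Λ : ℤ
  K = + k
  Λ = + lam

  r : Fin v → ℤ
  r x = ∑[ i < b ] χ i x

  gram : Fin b → Fin b → ℤ
  gram i j = ∑[ x < v ] (χ i x * χ j x)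

  gram≡card : ∀ i j → gram i j ≡ + ∣ B i ∩ B j ∣
  gram≡card i j = sym (card-∩≡∑ (B i) (B j))

  ∑-χ : ∀ i → ∑[ x < v ] χ i x ≡ K
  ∑-χ i = trans (sym (card≡∑ (B i))) (cong +_ (proj₁ design i))

  concurrence-≢ : ∀ {x y} → ¬ x ≡ y → ∑[ i < b ] (χ i x * χ i y) ≡ Λ
  concurrence-≢ {x} {y} x≢y = begin
    ∑[ i < b ] (χ i x * χ i y)                      ≡⟨ sum-cong-≗ (λ i → sym (through i)) ⟩
    ∑[ i < b ] 𝟙 (lookup (blocksThrough B x y) i)   ≡⟨ sym (card≡∑ (blocksThrough B x y)) ⟩
    + ∣ blocksThrough B x y ∣                       ≡⟨ cong +_ (proj₂ design x y x≢y) ⟩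
    Λ                                               ∎
    where
    through : ∀ i → 𝟙 (lookup (blocksThrough B x y) i) ≡ χ i x * χ i y
    through i = trans (cong 𝟙 (lookup∘tabulate (λ i → lookup (B i) x ∧ lookup (B i) y) i))
                      (𝟙-∧ (lookup (B i) x) (lookup (B i) y))

  concurrence : ∀ x y → ∑[ i < b ] (χ i x * χ i y) ≡ Λ + (r x - Λ) * δ x y
  concurrence x y with x ≟ y
  ... | yes refl = trans (sum-cong-≗ (λ i → 𝟙-idem (lookup (B i) x))) (diagonal (r x) Λ)
    where
    diagonal : ∀ r Λ → r ≡ Λ + (r - Λ) * 1ℤ
    diagonal = solve-∀
  ... | no x≢y = trans (concurrence-≢ x≢y) (off-diagonal (r x) Λ)
    where
    off-diagonal : ∀ r Λ → Λ ≡ Λ + (r - Λ) * 0ℤ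
    off-diagonal = solve-∀

  double-count : ∀ x (F : Fin v → ℤ) →
                 ∑[ i < b ] (χ i x * ∑[ y < v ] (χ i y * F y)) ≡ Λ * ∑[ y < v ] F y + (r x - Λ) * F x
  double-count x F = begin
    ∑[ i < b ] (χ i x * ∑[ y < v ] (χ i y * F y))
      ≡⟨ ∑-*-∑ (λ i → χ i x) (λ i y → χ i y * F y) ⟩
    ∑[ y < v ] ∑[ i < b ] (χ i x * (χ i y * F y))
      ≡⟨ sum-cong-≗ (λ y → trans (sum-cong-≗ (λ i → sym (ℤP.*-assoc (χ i x) (χ i y) (F y))))
                                  (∑-*ʳ (F y) (λ i → χ i x * χ i y))) ⟩
    ∑[ y < v ] (∑[ i < b ] (χ i x * χ i y) * F y)
      ≡⟨ sum-cong-≗ (λ y → cong (_* F y) (concurrence x y)) ⟩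
    ∑[ y < v ] ((Λ + (r x - Λ) * δ x y) * F y)
      ≡⟨ sum-cong-≗ (λ y → expand Λ (r x - Λ) (δ x y) (F y)) ⟩
    ∑[ y < v ] (Λ * F y + (r x - Λ) * (δ x y * F y))
      ≡⟨ ∑-distrib-+ (λ y → Λ * F y) (λ y → (r x - Λ) * (δ x y * F y)) ⟩
    ∑[ y < v ] (Λ * F y) + ∑[ y < v ] ((r x - Λ) * (δ x y * F y))
      ≡⟨ cong₂ _+_ (∑-*ˡ Λ F) (trans (∑-*ˡ (r x - Λ) (λ y → δ x y * F y)) (cong ((r x - Λ) *_) (∑-δ x F))) ⟩
    Λ * ∑[ y < v ] F y + (r x - Λ) * F x ∎
    where
    expand : ∀ a c d f → (a + c * d) * f ≡ a * f + c * (d * f)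
    expand = solve-∀

  replication-equation : ∀ x → (K - 1ℤ) * r x ≡ Λ * (+ v - 1ℤ)
  replication-equation x = rearrange (r x) (begin
    r x * K                                           ≡⟨ sym (∑-*ʳ K (λ i → χ i x)) ⟩
    ∑[ i < b ] (χ i x * K)                            ≡⟨ sum-cong-≗ (λ i → cong (χ i x *_) (sym (block-sum i))) ⟩
    ∑[ i < b ] (χ i x * ∑[ y < v ] (χ i y * 1ℤ))      ≡⟨ double-count x (λ _ → 1ℤ) ⟩
    Λ * ∑[ y < v ] 1ℤ + (r x - Λ) * 1ℤ                ≡⟨ cong (λ t → Λ * t + (r x - Λ) * 1ℤ) (∑-const v 1ℤ) ⟩
    Λ * (+ v * 1ℤ) + (r x - Λ) * 1ℤ                   ∎)
    where
    block-sum : ∀ i → ∑[ y < v ] (χ i y * 1ℤ) ≡ K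
    block-sum i = trans (sum-cong-≗ (λ y → ℤP.*-identityʳ (χ i y))) (∑-χ i)
    rearrange : ∀ r → r * K ≡ Λ * (+ v * 1ℤ) + (r - Λ) * 1ℤ → (K - 1ℤ) * r ≡ Λ * (+ v - 1ℤ)
    rearrange r eq = begin
      (K - 1ℤ) * r                           ≡⟨ lhs K r ⟩
      r * K - r                              ≡⟨ cong (_- r) eq ⟩
      Λ * (+ v * 1ℤ) + (r - Λ) * 1ℤ - r      ≡⟨ rhs Λ (+ v) r ⟩
      Λ * (+ v - 1ℤ)                         ∎
      where
      lhs : ∀ K r → (K - 1ℤ) * r ≡ r * K - r
      lhs = solve-∀
      rhs : ∀ Λ V r → Λ * (V * 1ℤ) + (r - Λ) * 1ℤ - r ≡ Λ * (V - 1ℤ)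
      rhs = solve-∀

  replication-constant : ¬ k ≡ 1 → ∀ x y → r x ≡ r y
  replication-constant k≢1 x y with ℤP.i*j≡0⇒i≡0∨j≡0 (K - 1ℤ) (begin
    (K - 1ℤ) * (r x - r y)                        ≡⟨ distrib (K - 1ℤ) (r x) (r y) ⟩
    (K - 1ℤ) * r x - (K - 1ℤ) * r y               ≡⟨ cong₂ _-_ (replication-equation x) (replication-equation y) ⟩
    Λ * (+ v - 1ℤ) - Λ * (+ v - 1ℤ)               ≡⟨ ℤP.+-inverseʳ (Λ * (+ v - 1ℤ)) ⟩
    0ℤ                                            ∎)
    where
    distrib : ∀ a x y → a * (x - y) ≡ a * x - a * y
    distrib = solve-∀
  ... | inj₁ K-1≡0 = ⊥-elim (k≢1 (ℤP.+-injective (ℤP.i-j≡0⇒i≡j K 1ℤ K-1≡0)))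
  ... | inj₂ rx-ry≡0 = ℤP.i-j≡0⇒i≡j (r x) (r y) rx-ry≡0

  r-Λ≡separating-blocks : ∀ {x x'} → ¬ x ≡ x' → r x - Λ ≡ ∑[ i < b ] (χ i x * (1ℤ - χ i x'))
  r-Λ≡separating-blocks {x} {x'} x≢x' = begin
    r x - Λ                                        ≡⟨ cong (λ t → r x - t) (sym (concurrence-≢ x≢x')) ⟩
    r x - ∑[ i < b ] (χ i x * χ i x')              ≡⟨ sym (∑-distrib-- (λ i → χ i x) (λ i → χ i x * χ i x')) ⟩
    ∑[ i < b ] (χ i x - χ i x * χ i x')            ≡⟨ sum-cong-≗ (λ i → factor (χ i x) (χ i x')) ⟩
    ∑[ i < b ] (χ i x * (1ℤ - χ i x'))             ∎
    where
    factor : ∀ a c → a - a * c ≡ a * (1ℤ - c)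
    factor = solve-∀

  lift : (Fin b → ℤ) → Fin v → ℤ
  lift w x = ∑[ j < b ] (w j * χ j x)

  IsEigenvector : (Fin b → ℤ) → ℤ → Set
  IsEigenvector w θ = ∀ i → ∑[ j < b ] (gram i j * w j) ≡ θ * w i

  lift-adjoint : ∀ w i → ∑[ x < v ] (χ i x * lift w x) ≡ ∑[ j < b ] (gram i j * w j)
  lift-adjoint w i = begin
    ∑[ x < v ] (χ i x * lift w x)                   ≡⟨ ∑-*-∑ (χ i) (λ x j → w j * χ j x) ⟩
    ∑[ j < b ] ∑[ x < v ] (χ i x * (w j * χ j x))   ≡⟨ sum-cong-≗ (λ j →
                                                          trans (sum-cong-≗ (λ x → swap (χ i x) (w j) (χ j x)))
                                                                (∑-*ʳ (w j) (λ x → χ i x * χ j x))) ⟩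
    ∑[ j < b ] (gram i j * w j)                     ∎
    where
    swap : ∀ a c d → a * (c * d) ≡ a * d * c
    swap = solve-∀

  ∑-lift : ∀ w → ∑[ x < v ] lift w x ≡ ∑[ j < b ] w j * K
  ∑-lift w = begin
    ∑[ x < v ] lift w x                    ≡⟨ ∑-comm (λ x j → w j * χ j x) ⟩
    ∑[ j < b ] ∑[ x < v ] (w j * χ j x)    ≡⟨ sum-cong-≗ (λ j → trans (∑-*ˡ (w j) (χ j)) (cong (w j *_) (∑-χ j))) ⟩
    ∑[ j < b ] (w j * K)                   ≡⟨ ∑-*ʳ K w ⟩
    ∑[ j < b ] w j * K                     ∎

  module _ {w : Fin b → ℤ} {θ : ℤ} (eigen : IsEigenvector w θ) where

    lift-eigen : ∑[ j < b ] w j ≡ 0ℤ → ∀ x → (r x - Λ) * lift w x ≡ θ * lift w x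
    lift-eigen ∑w≡0 x = begin
      (r x - Λ) * lift w x                                        ≡⟨ add-zero (Λ * ∑[ y < v ] lift w y) _ ∑lift≡0 ⟩
      Λ * ∑[ y < v ] lift w y + (r x - Λ) * lift w x              ≡⟨ sym (double-count x (lift w)) ⟩
      ∑[ i < b ] (χ i x * ∑[ y < v ] (χ i y * lift w y))
        ≡⟨ sum-cong-≗ (λ i → cong (χ i x *_) (trans (lift-adjoint w i) (eigen i))) ⟩
      ∑[ i < b ] (χ i x * (θ * w i))                              ≡⟨ sum-cong-≗ (λ i → swap (χ i x) θ (w i)) ⟩
      ∑[ i < b ] (θ * (w i * χ i x))                              ≡⟨ ∑-*ˡ θ (λ i → w i * χ i x) ⟩
      θ * lift w x                                                ∎
      where
      ∑lift≡0 : Λ * ∑[ y < v ] lift w y ≡ 0ℤ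
      ∑lift≡0 = trans (cong (Λ *_) (trans (∑-lift w) (trans (cong (_* K) ∑w≡0) (ℤP.*-zeroˡ K)))) (ℤP.*-zeroʳ Λ)
      add-zero : ∀ z a → z ≡ 0ℤ → a ≡ z + a
      add-zero z a refl = sym (ℤP.+-identityˡ a)
      swap : ∀ c t d → c * (t * d) ≡ t * (d * c)
      swap = solve-∀

    lift-norm : ∑[ x < v ] (lift w x * lift w x) ≡ θ * ∑[ j < b ] (w j * w j)
    lift-norm = begin
      ∑[ x < v ] (lift w x * lift w x)                 ≡⟨ ∑-*-∑ (lift w) (λ x j → w j * χ j x) ⟩
      ∑[ j < b ] ∑[ x < v ] (lift w x * (w j * χ j x)) ≡⟨ sum-cong-≗ (λ j →
                                                            trans (sum-cong-≗ (λ x → swap (lift w x) (w j) (χ j x)))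
                                                                  (∑-*ˡ (w j) (λ x → χ j x * lift w x))) ⟩
      ∑[ j < b ] (w j * ∑[ x < v ] (χ j x * lift w x)) ≡⟨ sum-cong-≗ (λ j →
                                                            cong (w j *_) (trans (lift-adjoint w j) (eigen j))) ⟩
      ∑[ j < b ] (w j * (θ * w j))                     ≡⟨ sum-cong-≗ (λ j → swap (w j) θ (w j)) ⟩
      ∑[ j < b ] (θ * (w j * w j))                     ≡⟨ ∑-*ˡ θ (λ j → w j * w j) ⟩
      θ * ∑[ j < b ] (w j * w j)                       ∎
      where
      swap : ∀ y c d → y * (c * d) ≡ c * (d * y)
      swap = solve-∀

    eigenvalue≡r-Λ : ∑[ j < b ] w j ≡ 0ℤ → ¬ θ ≡ 0ℤ → ∀ i → ¬ w i ≡ 0ℤ → ∃ λ x → r x - Λ ≡ θ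
    eigenvalue≡r-Λ ∑w≡0 θ≢0 i wi≢0 =
      let x , lift≢0 = ¬∀⟶∃¬ v (λ x → lift w x ≡ 0ℤ) (λ x → lift w x ℤP.≟ 0ℤ) lift-nonzero
      in x , *-cancelʳ-≢0 (r x - Λ) θ lift≢0 (lift-eigen ∑w≡0 x)
      where
      lift-nonzero : ¬ (∀ x → lift w x ≡ 0ℤ)
      lift-nonzero lift≡0 with ℤP.i*j≡0⇒i≡0∨j≡0 θ (begin
        θ * w i                           ≡⟨ sym (trans (lift-adjoint w i) (eigen i)) ⟩
        ∑[ x < v ] (χ i x * lift w x)     ≡⟨ sum-cong-≗ (λ x → trans (cong (χ i x *_) (lift≡0 x))
                                                                     (ℤP.*-zeroʳ (χ i x))) ⟩
        ∑[ x < v ] 0ℤ                     ≡⟨ trans (∑-const v 0ℤ) (ℤP.*-zeroʳ (+ v)) ⟩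
        0ℤ                                ∎)
      ... | inj₁ θ≡0 = θ≢0 θ≡0
      ... | inj₂ wi≡0 = wi≢0 wi≡0

  null-eigenvector-lift≡0 : ∀ {w} → IsEigenvector w 0ℤ → ∀ x → lift w x ≡ 0ℤ
  null-eigenvector-lift≡0 {w} eigen =
    ∑-squares≡0⇒≡0 (lift w) (trans (lift-norm {θ = 0ℤ} eigen) (ℤP.*-zeroˡ (∑[ j < b ] (w j * w j))))

-- Blocks labelled by the pairs of an m-set

module PairLabelling {b m} (f : Fin b → Subset m) (f-pair : ∀ i → ∣ f i ∣ ≡ 2)
                     (f-injective : ∀ i j → f i ≡ f j → i ≡ j)
                     (f-onto : ∀ s → ∣ s ∣ ≡ 2 → ∃ λ i → f i ≡ s) where

  open ≡-Reasoning

  σ : Fin b → Fin m → ℤ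
  σ i s = 𝟙 (lookup (f i) s)

  M : ℤ
  M = + m

  blockOf : (p q : Fin m) → .(¬ p ≡ q) → Fin b
  blockOf p q p≢q = proj₁ (f-onto (pair p q) (recompute (∣ pair p q ∣ ℕ.≟ 2) (pair-card p≢q)))

  σ-blockOf : ∀ {p q} (p≢q : ¬ p ≡ q) z → σ (blockOf p q p≢q) z ≡ δ p z + δ q z
  σ-blockOf {p} {q} p≢q z =
    trans (cong (λ s → 𝟙 (lookup s z)) (proj₂ (f-onto (pair p q) _))) (𝟙-pair p≢q z)

  blockOf-unique : ∀ j {p q} (p≢q : ¬ p ≡ q) → lookup (f j) p ≡ true → lookup (f j) q ≡ true →
                   j ≡ blockOf p q p≢q
  blockOf-unique j {p} {q} p≢q fjp fjq = f-injective j (blockOf p q p≢q)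
    (trans (two-subset≡pair (f j) (f-pair j) p≢q fjp fjq) (sym (proj₂ (f-onto (pair p q) _))))

  block-is-pair : ∀ j → ∃₂ λ p q → Σ (¬ p ≡ q) λ p≢q → j ≡ blockOf p q p≢q
  block-is-pair j =
    let p , q , p≢q , fjp , fjq = count≥2⇒two-trues (lookup (f j))
                                    (ℤP.≤-reflexive (trans (cong +_ (sym (f-pair j))) (card≡∑ (f j))))
    in p , q , p≢q , blockOf-unique j p≢q fjp fjq

  blockOf-ends : ∀ {p q} (p≢q : ¬ p ≡ q) → lookup (f (blockOf p q p≢q)) p ≡ true × lookup (f (blockOf p q p≢q)) q ≡ true
  blockOf-ends {p} {q} p≢q =
      𝟙≡1⇒true (trans (σ-blockOf p≢q p) (cong₂ _+_ (δ-refl p) (δ-≢ (p≢q ∘ sym))))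
    , 𝟙≡1⇒true (trans (σ-blockOf p≢q q) (cong₂ _+_ (δ-≢ p≢q) (δ-refl q)))

  blockOf-outside : ∀ {p q} (p≢q : ¬ p ≡ q) {z} → ¬ p ≡ z → ¬ q ≡ z → lookup (f (blockOf p q p≢q)) z ≡ false
  blockOf-outside p≢q {z} p≢z q≢z = 𝟙≡0⇒false (trans (σ-blockOf p≢q z) (cong₂ _+_ (δ-≢ p≢z) (δ-≢ q≢z)))

  σσ≡δ : ∀ {p q} (p≢q : ¬ p ≡ q) j → σ j p * σ j q ≡ δ (blockOf p q p≢q) j
  σσ≡δ {p} {q} p≢q j with blockOf p q p≢q ≟ j
  ... | yes refl = cong₂ (λ a c → 𝟙 a * 𝟙 c) (proj₁ (blockOf-ends p≢q)) (proj₂ (blockOf-ends p≢q))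
  ... | no j≢block with lookup (f j) p in fjp | lookup (f j) q in fjq
  ...   | true  | true  = ⊥-elim (j≢block (sym (blockOf-unique j p≢q fjp fjq)))
  ...   | true  | false = refl
  ...   | false | _     = refl

  pairSum : Fin m → Fin m → (Fin b → ℤ) → ℤ
  pairSum p q F = ∑[ j < b ] (σ j p * σ j q * F j)

  pairSum-blockOf : ∀ {p q} (p≢q : ¬ p ≡ q) (F : Fin b → ℤ) → pairSum p q F ≡ F (blockOf p q p≢q)
  pairSum-blockOf p≢q F = trans (sum-cong-≗ (λ j → cong (_* F j) (σσ≡δ p≢q j))) (∑-δ _ F)

  pair-in-one-block : ∀ {p q} → ¬ p ≡ q → ∑[ j < b ] (σ j p * σ j q) ≡ 1ℤ
  pair-in-one-block {p} {q} p≢q =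
    trans (sum-cong-≗ (λ j → sym (ℤP.*-identityʳ (σ j p * σ j q)))) (pairSum-blockOf p≢q (λ _ → 1ℤ))

  ∑-σ : ∀ j → ∑[ s < m ] σ j s ≡ + 2
  ∑-σ j = trans (sym (card≡∑ (f j))) (cong +_ (f-pair j))

  -- Counting the pairs {p, s} through p twice: once per block, giving twice the degree D of p,
  -- and once per point s, giving D + (m - 1).
  point-degree : ∀ p → ∑[ j < b ] σ j p ≡ M - 1ℤ
  point-degree p = solve-for-D (∑[ j < b ] σ j p) (begin
    ∑[ j < b ] σ j p * + 2                         ≡⟨ sym (∑-*ʳ (+ 2) (λ j → σ j p)) ⟩
    ∑[ j < b ] (σ j p * + 2)                       ≡⟨ sum-cong-≗ (λ j → cong (σ j p *_) (sym (∑-σ j))) ⟩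
    ∑[ j < b ] (σ j p * ∑[ s < m ] σ j s)          ≡⟨ ∑-*-∑ (λ j → σ j p) σ ⟩
    ∑[ s < m ] ∑[ j < b ] (σ j p * σ j s)          ≡⟨ ∑-constant-except p 1ℤ _ (λ s → pair-in-one-block) ⟩
    ∑[ j < b ] (σ j p * σ j p) - 1ℤ + M * 1ℤ       ≡⟨ cong (λ t → t - 1ℤ + M * 1ℤ)
                                                           (sum-cong-≗ (λ j → 𝟙-idem (lookup (f j) p))) ⟩
    ∑[ j < b ] σ j p - 1ℤ + M * 1ℤ                 ∎)
    where
    solve-for-D : ∀ D → D * + 2 ≡ D - 1ℤ + M * 1ℤ → D ≡ M - 1ℤ
    solve-for-D D eq = begin
      D                              ≡⟨ lhs D ⟩
      D * + 2 - D                    ≡⟨ cong (_- D) eq ⟩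
      D - 1ℤ + M * 1ℤ - D            ≡⟨ rhs D M ⟩
      M - 1ℤ                         ∎
      where
      lhs : ∀ D → D ≡ D * + 2 - D
      lhs = solve-∀
      rhs : ∀ D M → D - 1ℤ + M * 1ℤ - D ≡ M - 1ℤ
      rhs = solve-∀

  coincidence : ∀ p q → ∑[ j < b ] (σ j p * σ j q) ≡ 1ℤ + (M - + 2) * δ p q
  coincidence p q with p ≟ q
  ... | yes refl = trans (sum-cong-≗ (λ j → 𝟙-idem (lookup (f j) p))) (trans (point-degree p) (degree M))
    where
    degree : ∀ M → M - 1ℤ ≡ 1ℤ + (M - + 2) * 1ℤ
    degree = solve-∀
  ... | no p≢q = trans (pair-in-one-block p≢q) (once M)
    where
    once : ∀ M → 1ℤ ≡ 1ℤ + (M - + 2) * 0ℤ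
    once = solve-∀

-- Quasi-symmetric designs whose block graph is T_m

module TriangularDesign {v b} (B : Blocks v b) (k lam l₁ l₂ : ℕ) (design : Is2Design B k lam)
  (intersections : ∀ i j → ¬ i ≡ j → ∣ B i ∩ B j ∣ ≡ l₁ ⊎ ∣ B i ∩ B j ∣ ≡ l₂)
  {m} (f : Fin b → Subset m) (f-pair : ∀ i → ∣ f i ∣ ≡ 2)
  (f-injective : ∀ i j → f i ≡ f j → i ≡ j)
  (f-onto : ∀ s → ∣ s ∣ ≡ 2 → ∃ λ i → f i ≡ s)
  (f-adjacency : ∀ i j → BlockAdj B l₂ i j ⇔ (¬ i ≡ j × TriAdj (f i) (f j))) where

  open TwoDesign B k lam design public
  open PairLabelling f f-pair f-injective f-onto public
  open ≡-Reasoning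

  A C μ θ-quad : ℤ
  A = + l₁
  C = + l₂
  μ = C - A
  θ-quad = K + A - C - C

  meet : Fin b → Fin b → ℤ
  meet i j = ∑[ s < m ] (σ i s * σ j s)

  meet-blockOf : ∀ i {p q} (p≢q : ¬ p ≡ q) → meet i (blockOf p q p≢q) ≡ σ i p + σ i q
  meet-blockOf i {p} {q} p≢q = begin
    meet i (blockOf p q p≢q)                        ≡⟨ sum-cong-≗ (λ s → cong (σ i s *_) (σ-blockOf p≢q s)) ⟩
    ∑[ s < m ] (σ i s * (δ p s + δ q s))               ≡⟨ sum-cong-≗ (λ s → distrib (σ i s) (δ p s) (δ q s)) ⟩
    ∑[ s < m ] (δ p s * σ i s + δ q s * σ i s)         ≡⟨ ∑-distrib-+ (λ s → δ p s * σ i s) (λ s → δ q s * σ i s) ⟩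
    ∑[ s < m ] (δ p s * σ i s) + ∑[ s < m ] (δ q s * σ i s)  ≡⟨ cong₂ _+_ (∑-δ p (σ i)) (∑-δ q (σ i)) ⟩
    σ i p + σ i q                                      ∎
    where
    distrib : ∀ a d e → a * (d + e) ≡ d * a + e * a
    distrib = solve-∀

  gram-diagonal : ∀ i → gram i i ≡ K
  gram-diagonal i = trans (sum-cong-≗ (λ x → 𝟙-idem (lookup (B i) x))) (∑-χ i)

  gram-adjacent : ∀ {i j} → ¬ i ≡ j → + ∣ f i ∩ f j ∣ ≡ 1ℤ → gram i j ≡ C
  gram-adjacent {i} {j} i≢j meet-once =
    trans (gram≡card i j) (cong +_ (proj₂ (Equivalence.from (f-adjacency i j) (i≢j , ℤP.+-injective meet-once))))

  gram-disjoint : ∀ {i j} → ¬ i ≡ j → + ∣ f i ∩ f j ∣ ≡ 0ℤ → gram i j ≡ A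
  gram-disjoint {i} {j} i≢j disjoint with intersections i j i≢j
  ... | inj₁ meet-l₁ = trans (gram≡card i j) (cong +_ meet-l₁)
  ... | inj₂ meet-l₂ with () ← trans (sym (ℤP.+-injective disjoint))
                                    (proj₂ (Equivalence.to (f-adjacency i j) (i≢j , meet-l₂)))

  -- Pairs meeting in 2, 1, 0 points label blocks meeting in k, l₂, l₁ points: affine in the meet,
  -- corrected on the diagonal by θ-quad.
  gram-formula : ∀ i j → gram i j ≡ A + μ * meet i j + θ-quad * δ i j
  gram-formula i j with block-is-pair j
  ... | p , q , p≢q , refl =
    trans (by-cases (lookup (f i) p) (lookup (f i) q) refl refl)
          (cong (λ t → A + μ * t + θ-quad * δ i j) (sym (meet-blockOf i p≢q)))
    where
    card-meet : ∀ {a c} → lookup (f i) p ≡ a → lookup (f i) q ≡ c → + ∣ f i ∩ f j ∣ ≡ 𝟙 a + 𝟙 c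
    card-meet fip fiq = trans (card-∩≡∑ (f i) (f j)) (trans (meet-blockOf i p≢q) (cong₂ (λ a c → 𝟙 a + 𝟙 c) fip fiq))

    distinct : ∀ {a c} → lookup (f i) p ≡ a → lookup (f i) q ≡ c → a ≡ false ⊎ c ≡ false → ¬ i ≡ j
    distinct fip _ (inj₁ refl) refl with () ← trans (sym fip) (proj₁ (blockOf-ends p≢q))
    distinct _ fiq (inj₂ refl) refl with () ← trans (sym fiq) (proj₂ (blockOf-ends p≢q))

    by-cases : ∀ a c → lookup (f i) p ≡ a → lookup (f i) q ≡ c → gram i j ≡ A + μ * (𝟙 a + 𝟙 c) + θ-quad * δ i j
    by-cases true true fip fiq with refl ← blockOf-unique i p≢q fip fiq =
      trans (gram-diagonal j)
            (trans (two K A C) (cong (λ t → A + μ * (1ℤ + 1ℤ) + θ-quad * t) (sym (δ-refl j))))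
      where
      two : ∀ K A C → K ≡ A + (C - A) * (1ℤ + 1ℤ) + (K + A - C - C) * 1ℤ
      two = solve-∀
    by-cases true false fip fiq =
      trans (gram-adjacent i≢j (card-meet fip fiq))
            (trans (one K A C) (cong (λ t → A + μ * (1ℤ + 0ℤ) + θ-quad * t) (sym (δ-≢ i≢j))))
      where
      i≢j = distinct fip fiq (inj₂ refl)
      one : ∀ K A C → C ≡ A + (C - A) * (1ℤ + 0ℤ) + (K + A - C - C) * 0ℤ
      one = solve-∀
    by-cases false true fip fiq =
      trans (gram-adjacent i≢j (card-meet fip fiq))
            (trans (one K A C) (cong (λ t → A + μ * (0ℤ + 1ℤ) + θ-quad * t) (sym (δ-≢ i≢j))))
      where
      i≢j = distinct fip fiq (inj₁ refl)
      one : ∀ K A C → C ≡ A + (C - A) * (0ℤ + 1ℤ) + (K + A - C - C) * 0ℤ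
      one = solve-∀
    by-cases false false fip fiq =
      trans (gram-disjoint i≢j (card-meet fip fiq))
            (trans (none K A C) (cong (λ t → A + μ * (0ℤ + 0ℤ) + θ-quad * t) (sym (δ-≢ i≢j))))
      where
      i≢j = distinct fip fiq (inj₁ refl)
      none : ∀ K A C → A ≡ A + (C - A) * (0ℤ + 0ℤ) + (K + A - C - C) * 0ℤ
      none = solve-∀

  ∑-meet : ∀ i (w : Fin b → ℤ) → ∑[ j < b ] (meet i j * w j) ≡ ∑[ s < m ] (σ i s * ∑[ j < b ] (σ j s * w j))
  ∑-meet i w = sym (begin
    ∑[ s < m ] (σ i s * ∑[ j < b ] (σ j s * w j))     ≡⟨ ∑-*-∑ (σ i) (λ s j → σ j s * w j) ⟩
    ∑[ j < b ] ∑[ s < m ] (σ i s * (σ j s * w j))     ≡⟨ sum-cong-≗ (λ j →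
                                                            trans (sum-cong-≗ (λ s → sym (ℤP.*-assoc (σ i s) (σ j s) (w j))))
                                                                  (∑-*ʳ (w j) (λ s → σ i s * σ j s))) ⟩
    ∑[ j < b ] (meet i j * w j)                        ∎)

  gram-action : ∀ (w : Fin b → ℤ) → ∑[ j < b ] w j ≡ 0ℤ → ∀ i →
                ∑[ j < b ] (gram i j * w j) ≡ μ * ∑[ s < m ] (σ i s * ∑[ j < b ] (σ j s * w j)) + θ-quad * w i
  gram-action w ∑w≡0 i = begin
    ∑[ j < b ] (gram i j * w j)
      ≡⟨ sum-cong-≗ (λ j → trans (cong (_* w j) (gram-formula i j)) (expand A μ θ-quad (meet i j) (δ i j) (w j))) ⟩
    ∑[ j < b ] (A * w j + (μ * (meet i j * w j) + θ-quad * (δ i j * w j)))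
      ≡⟨ ∑-distrib-+ (λ j → A * w j) (λ j → μ * (meet i j * w j) + θ-quad * (δ i j * w j)) ⟩
    ∑[ j < b ] (A * w j) + ∑[ j < b ] (μ * (meet i j * w j) + θ-quad * (δ i j * w j))
      ≡⟨ cong₂ _+_ (trans (∑-*ˡ A w) (trans (cong (A *_) ∑w≡0) (ℤP.*-zeroʳ A)))
                   (∑-distrib-+ (λ j → μ * (meet i j * w j)) (λ j → θ-quad * (δ i j * w j))) ⟩
    0ℤ + (∑[ j < b ] (μ * (meet i j * w j)) + ∑[ j < b ] (θ-quad * (δ i j * w j)))
      ≡⟨ ℤP.+-identityˡ _ ⟩
    ∑[ j < b ] (μ * (meet i j * w j)) + ∑[ j < b ] (θ-quad * (δ i j * w j))
      ≡⟨ cong₂ _+_ (trans (∑-*ˡ μ (λ j → meet i j * w j)) (cong (μ *_) (∑-meet i w)))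
                   (trans (∑-*ˡ θ-quad (λ j → δ i j * w j)) (cong (θ-quad *_) (∑-δ i w))) ⟩
    μ * ∑[ s < m ] (σ i s * ∑[ j < b ] (σ j s * w j)) + θ-quad * w i ∎
    where
    expand : ∀ A μ θ n d w → (A + μ * n + θ * d) * w ≡ A * w + (μ * (n * w) + θ * (d * w))
    expand = solve-∀

  module Quadrangle {p q s t : Fin m} (p≢q : ¬ p ≡ q) (p≢s : ¬ p ≡ s) (p≢t : ¬ p ≡ t)
                    (q≢s : ¬ q ≡ s) (q≢t : ¬ q ≡ t) (s≢t : ¬ s ≡ t) where

    quadrangle : Fin b → ℤ
    quadrangle j = σ j p * σ j q + σ j s * σ j t - σ j p * σ j s - σ j q * σ j t

    ∑-quadrangle : ∀ F → ∑[ j < b ] (quadrangle j * F j) ≡ pairSum p q F + pairSum s t F - pairSum p s F - pairSum q t F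
    ∑-quadrangle F =
      trans (sum-cong-≗ (λ j → expand (σ j p) (σ j q) (σ j s) (σ j t) (F j)))
            (∑-distrib-+-- (λ j → σ j p * σ j q * F j) (λ j → σ j s * σ j t * F j)
                           (λ j → σ j p * σ j s * F j) (λ j → σ j q * σ j t * F j))
      where
      expand : ∀ a c d e x → (a * c + d * e - a * d - c * e) * x ≡ a * c * x + d * e * x - a * d * x - c * e * x
      expand = solve-∀

    ∑-quadrangle-at-pairs : ∀ F → ∑[ j < b ] (quadrangle j * F j) ≡
      F (blockOf p q p≢q) + F (blockOf s t s≢t) - F (blockOf p s p≢s) - F (blockOf q t q≢t)
    ∑-quadrangle-at-pairs F =
      trans (∑-quadrangle F)
            (cong₂ _-_ (cong₂ _-_ (cong₂ _+_ (pairSum-blockOf p≢q F) (pairSum-blockOf s≢t F))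
                                  (pairSum-blockOf p≢s F))
                       (pairSum-blockOf q≢t F))

    ∑-quadrangle≡0 : ∑[ j < b ] quadrangle j ≡ 0ℤ
    ∑-quadrangle≡0 = trans (sum-cong-≗ (λ j → sym (ℤP.*-identityʳ (quadrangle j)))) (∑-quadrangle-at-pairs (λ _ → 1ℤ))

    -- Each of p, q, s, t lies in exactly one positive and one negative pair of the quadrangle.
    quadrangle-balanced : ∀ z → ∑[ j < b ] (σ j z * quadrangle j) ≡ 0ℤ
    quadrangle-balanced z = begin
      ∑[ j < b ] (σ j z * quadrangle j)          ≡⟨ sum-cong-≗ (λ j → ℤP.*-comm (σ j z) (quadrangle j)) ⟩
      ∑[ j < b ] (quadrangle j * σ j z)          ≡⟨ ∑-quadrangle-at-pairs (λ j → σ j z) ⟩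
      σ (blockOf p q p≢q) z + σ (blockOf s t s≢t) z - σ (blockOf p s p≢s) z - σ (blockOf q t q≢t) z
        ≡⟨ cong₂ _-_ (cong₂ _-_ (cong₂ _+_ (σ-blockOf p≢q z) (σ-blockOf s≢t z)) (σ-blockOf p≢s z))
                     (σ-blockOf q≢t z) ⟩
      δ p z + δ q z + (δ s z + δ t z) - (δ p z + δ s z) - (δ q z + δ t z) ≡⟨ cancel (δ p z) (δ q z) (δ s z) (δ t z) ⟩
      0ℤ                                         ∎
      where
      cancel : ∀ a c d e → a + c + (d + e) - (a + d) - (c + e) ≡ 0ℤ
      cancel = solve-∀

    quadrangle-eigen : IsEigenvector quadrangle θ-quad
    quadrangle-eigen i = begin
      ∑[ j < b ] (gram i j * quadrangle j)
        ≡⟨ gram-action quadrangle ∑-quadrangle≡0 i ⟩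
      μ * ∑[ s < m ] (σ i s * ∑[ j < b ] (σ j s * quadrangle j)) + θ-quad * quadrangle i
        ≡⟨ cong (λ x → μ * x + θ-quad * quadrangle i)
                (trans (sum-cong-≗ (λ z → trans (cong (σ i z *_) (quadrangle-balanced z)) (ℤP.*-zeroʳ (σ i z))))
                       (trans (∑-const m 0ℤ) (ℤP.*-zeroʳ M))) ⟩
      μ * 0ℤ + θ-quad * quadrangle i
        ≡⟨ trans (cong (_+ θ-quad * quadrangle i) (ℤP.*-zeroʳ μ)) (ℤP.+-identityˡ _) ⟩
      θ-quad * quadrangle i ∎

    quadrangle-nonzero : quadrangle (blockOf p q p≢q) ≡ 1ℤ
    quadrangle-nonzero
      rewrite proj₁ (blockOf-ends p≢q) | proj₂ (blockOf-ends p≢q)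
            | blockOf-outside p≢q p≢s q≢s | blockOf-outside p≢q p≢t q≢t = refl

  θ-star : ℤ
  θ-star = μ * (M - + 2) + θ-quad

  module Star {a d : Fin m} (a≢d : ¬ a ≡ d) where

    star : Fin b → ℤ
    star j = σ j a - σ j d

    ∑-star≡0 : ∑[ j < b ] star j ≡ 0ℤ
    ∑-star≡0 = trans (∑-distrib-- (λ j → σ j a) (λ j → σ j d))
                     (trans (cong₂ _-_ (point-degree a) (point-degree d)) (ℤP.+-inverseʳ (M - 1ℤ)))

    star-image : ∀ s → ∑[ j < b ] (σ j s * star j) ≡ (M - + 2) * (δ a s - δ d s)
    star-image s = begin
      ∑[ j < b ] (σ j s * star j)                                  ≡⟨ sum-cong-≗ (λ j → distrib (σ j s) (σ j a) (σ j d)) ⟩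
      ∑[ j < b ] (σ j a * σ j s - σ j d * σ j s)
        ≡⟨ ∑-distrib-- (λ j → σ j a * σ j s) (λ j → σ j d * σ j s) ⟩
      ∑[ j < b ] (σ j a * σ j s) - ∑[ j < b ] (σ j d * σ j s)      ≡⟨ cong₂ _-_ (coincidence a s) (coincidence d s) ⟩
      1ℤ + (M - + 2) * δ a s - (1ℤ + (M - + 2) * δ d s)            ≡⟨ cancel (M - + 2) (δ a s) (δ d s) ⟩
      (M - + 2) * (δ a s - δ d s)                                  ∎
      where
      distrib : ∀ x y z → x * (y - z) ≡ y * x - z * x
      distrib = solve-∀
      cancel : ∀ c x y → 1ℤ + c * x - (1ℤ + c * y) ≡ c * (x - y)
      cancel = solve-∀

    star-eigen : IsEigenvector star θ-star
    star-eigen i = begin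
      ∑[ j < b ] (gram i j * star j)
        ≡⟨ gram-action star ∑-star≡0 i ⟩
      μ * ∑[ s < m ] (σ i s * ∑[ j < b ] (σ j s * star j)) + θ-quad * star i
        ≡⟨ cong (λ x → μ * x + θ-quad * star i) (sum-cong-≗ (λ s → cong (σ i s *_) (star-image s))) ⟩
      μ * ∑[ s < m ] (σ i s * ((M - + 2) * (δ a s - δ d s))) + θ-quad * star i
        ≡⟨ cong (λ x → μ * x + θ-quad * star i) (begin
             ∑[ s < m ] (σ i s * ((M - + 2) * (δ a s - δ d s)))
               ≡⟨ sum-cong-≗ (λ s → reorder (σ i s) (M - + 2) (δ a s) (δ d s)) ⟩
             ∑[ s < m ] ((M - + 2) * (δ a s * σ i s - δ d s * σ i s))
               ≡⟨ ∑-*ˡ (M - + 2) (λ s → δ a s * σ i s - δ d s * σ i s) ⟩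
             (M - + 2) * ∑[ s < m ] (δ a s * σ i s - δ d s * σ i s)
               ≡⟨ cong ((M - + 2) *_) (trans (∑-distrib-- (λ s → δ a s * σ i s) (λ s → δ d s * σ i s))
                                              (cong₂ _-_ (∑-δ a (σ i)) (∑-δ d (σ i)))) ⟩
             (M - + 2) * star i ∎) ⟩
      μ * ((M - + 2) * star i) + θ-quad * star i
        ≡⟨ collect μ (M - + 2) θ-quad (star i) ⟩
      θ-star * star i ∎
      where
      reorder : ∀ x c y z → x * (c * (y - z)) ≡ c * (y * x - z * x)
      reorder = solve-∀
      collect : ∀ μ c θ w → μ * (c * w) + θ * w ≡ (μ * c + θ) * w
      collect = solve-∀

    star-nonzero : ∀ {p} (a≢p : ¬ a ≡ p) → ¬ d ≡ p → star (blockOf a p a≢p) ≡ 1ℤ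
    star-nonzero a≢p d≢p rewrite proj₁ (blockOf-ends a≢p) | blockOf-outside a≢p (a≢d) (d≢p ∘ sym) = refl

  module Numerology (l₁≤l₂ : l₁ ≤ l₂) (2≤μ : 2 ≤ l₂ ∸ l₁) (l₂≤k : l₂ ≤ k) (4≤m : 4 ≤ m) where

    +2≤μ : + 2 ℤ.≤ μ
    +2≤μ = subst (+ 2 ℤ.≤_) (+∸ l₁≤l₂) (+≤+ 2≤μ)

    k≢1 : ¬ k ≡ 1
    k≢1 refl with s≤s () ← ℕP.≤-trans 2≤μ (ℕP.≤-trans (ℕP.m∸n≤m l₂ l₁) l₂≤k)

    θ-star≡ : θ-star ≡ + ((l₂ ∸ l₁) ℕ.* (m ∸ 3) ℕ.+ (k ∸ l₂))
    θ-star≡ = begin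
      θ-star                                      ≡⟨ regroup K A C M ⟩
      (C - A) * (M - + 3) + (K - C)               ≡⟨ cong₂ (λ x y → x * y + (K - C)) (sym (+∸ l₁≤l₂)) (sym (+∸ 3≤m)) ⟩
      + (l₂ ∸ l₁) * + (m ∸ 3) + (K - C)           ≡⟨ cong₂ _+_ (sym (ℤP.pos-* (l₂ ∸ l₁) (m ∸ 3))) (sym (+∸ l₂≤k)) ⟩
      + ((l₂ ∸ l₁) ℕ.* (m ∸ 3)) + + (k ∸ l₂)      ≡⟨ sym (ℤP.pos-+ ((l₂ ∸ l₁) ℕ.* (m ∸ 3)) (k ∸ l₂)) ⟩
      + ((l₂ ∸ l₁) ℕ.* (m ∸ 3) ℕ.+ (k ∸ l₂))      ∎
      where
      3≤m = ℕP.≤-trans (ℕP.n≤1+n 3) 4≤m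
      regroup : ∀ K A C M → (C - A) * (M - + 2) + (K + A - C - C) ≡ (C - A) * (M - + 3) + (K - C)
      regroup = solve-∀

    θ-star-θ-quad≡ : θ-star - θ-quad ≡ + ((l₂ ∸ l₁) ℕ.* (m ∸ 2))
    θ-star-θ-quad≡ = begin
      θ-star - θ-quad                ≡⟨ cancel (μ * (M - + 2)) θ-quad ⟩
      μ * (M - + 2)                  ≡⟨ cong₂ _*_ (sym (+∸ l₁≤l₂)) (sym (+∸ 2≤m)) ⟩
      + (l₂ ∸ l₁) * + (m ∸ 2)        ≡⟨ sym (ℤP.pos-* (l₂ ∸ l₁) (m ∸ 2)) ⟩
      + ((l₂ ∸ l₁) ℕ.* (m ∸ 2))      ∎
      where
      2≤m = ℕP.≤-trans (ℕP.≤-trans (ℕP.n≤1+n 2) (ℕP.n≤1+n 3)) 4≤m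
      cancel : ∀ x y → x + y - y ≡ x
      cancel = solve-∀

    private
      2≤θ-star : 2 ≤ (l₂ ∸ l₁) ℕ.* (m ∸ 3) ℕ.+ (k ∸ l₂)
      2≤θ-star = ℕP.≤-trans (ℕP.*-mono-≤ 2≤μ (ℕP.∸-monoˡ-≤ 3 4≤m)) (ℕP.m≤m+n _ (k ∸ l₂))

      2≤θ-star-θ-quad : 2 ≤ (l₂ ∸ l₁) ℕ.* (m ∸ 2)
      2≤θ-star-θ-quad = ℕP.≤-trans (s≤s (s≤s z≤n)) (ℕP.*-mono-≤ 2≤μ (ℕP.∸-monoˡ-≤ 2 4≤m))

    θ-star≢0 : ¬ θ-star ≡ 0ℤ
    θ-star≢0 θ-star≡0 = ≥2⇒¬binary 2≤θ-star (inj₁ (trans (sym θ-star≡) θ-star≡0))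

    θ-star≢θ-quad : ¬ θ-star ≡ θ-quad
    θ-star≢θ-quad eq = ≥2⇒¬binary 2≤θ-star-θ-quad (inj₁ (trans (sym θ-star-θ-quad≡) (ℤP.i≡j⇒i-j≡0 eq)))

    θ-star-not-binary : θ-quad ≡ 0ℤ → ¬ Binary θ-star
    θ-star-not-binary θ-quad≡0 =
      ≥2⇒¬binary 2≤θ-star-θ-quad ∘ subst Binary (trans θ-star≡θ-star-θ-quad θ-star-θ-quad≡)
      where
      θ-star≡θ-star-θ-quad : θ-star ≡ θ-star - θ-quad
      θ-star≡θ-star-θ-quad = sym (trans (cong (λ t → θ-star - t) θ-quad≡0) (ℤP.+-identityʳ θ-star))

  replication-gap≡θ-star : ¬ k ≡ 1 → ¬ θ-star ≡ 0ℤ →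
    ∀ (a d p : Fin m) → ¬ a ≡ d → ¬ a ≡ p → ¬ d ≡ p → ∀ x → r x - Λ ≡ θ-star
  replication-gap≡θ-star k≢1 θ-star≢0 a d p a≢d a≢p d≢p x =
    let y , gap≡θ = eigenvalue≡r-Λ star-eigen ∑-star≡0 θ-star≢0 _
                      (λ w≡0 → 1≢0 (trans (sym (star-nonzero a≢p d≢p)) w≡0))
    in trans (cong (_- Λ) (replication-constant k≢1 x y)) gap≡θ
    where open Star a≢d

  θ-quad-vanishes : (∀ x → r x - Λ ≡ θ-star) → ¬ θ-star ≡ θ-quad →
    ∀ (p q s t : Fin m) → ¬ p ≡ q → ¬ p ≡ s → ¬ p ≡ t → ¬ q ≡ s → ¬ q ≡ t → ¬ s ≡ t → θ-quad ≡ 0ℤ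
  θ-quad-vanishes gap≡θ-star θ-star≢θ-quad p q s t p≢q p≢s p≢t q≢s q≢t s≢t with θ-quad ℤP.≟ 0ℤ
  ... | yes θ≡0 = θ≡0
  ... | no θ≢0 =
    let y , gap≡θ = eigenvalue≡r-Λ quadrangle-eigen ∑-quadrangle≡0 θ≢0 _
                      (λ w≡0 → 1≢0 (trans (sym quadrangle-nonzero) w≡0))
    in ⊥-elim (θ-star≢θ-quad (trans (sym (gap≡θ-star y)) gap≡θ))
    where open Quadrangle p≢q p≢s p≢t q≢s q≢t s≢t

  linkEdge : Fin v → Fin m → Fin m → ℤ
  linkEdge x p q = pairSum p q (λ j → χ j x)

  linkEdge-blockOf : ∀ x {p q} (p≢q : ¬ p ≡ q) → linkEdge x p q ≡ χ (blockOf p q p≢q) x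
  linkEdge-blockOf x p≢q = pairSum-blockOf p≢q (λ j → χ j x)

  -- When θ-quad = 0 the quadrangle vectors lift to zero, which is the quadrangle rule for the
  -- pairs whose blocks contain x.
  link : θ-quad ≡ 0ℤ → Fin v → QuadrangleGraph m
  link θ-quad≡0 x = record
    { edge = linkEdge x
    ; symmetric = λ p q → sum-cong-≗ (λ j → cong (_* χ j x) (ℤP.*-comm (σ j p) (σ j q)))
    ; binary = λ p≢q → subst Binary (sym (linkEdge-blockOf x p≢q)) (𝟙-binary _)
    ; quadrangle-rule = rule
    }
    where
    rule : ∀ {p q s t} → ¬ p ≡ q → ¬ p ≡ s → ¬ p ≡ t → ¬ q ≡ s → ¬ q ≡ t → ¬ s ≡ t →
           linkEdge x p q + linkEdge x s t ≡ linkEdge x p s + linkEdge x q t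
    rule {p} {q} {s} {t} p≢q p≢s p≢t q≢s q≢t s≢t =
      ℤP.i-j≡0⇒i≡j _ _ (begin
        linkEdge x p q + linkEdge x s t - (linkEdge x p s + linkEdge x q t)
          ≡⟨ regroup (linkEdge x p q) (linkEdge x s t) (linkEdge x p s) (linkEdge x q t) ⟩
        linkEdge x p q + linkEdge x s t - linkEdge x p s - linkEdge x q t
          ≡⟨ sym (∑-quadrangle (λ j → χ j x)) ⟩
        lift quadrangle x
          ≡⟨ null-eigenvector-lift≡0 (subst (IsEigenvector quadrangle) θ-quad≡0 quadrangle-eigen) x ⟩
        0ℤ ∎)
      where
      open Quadrangle p≢q p≢s p≢t q≢s q≢t s≢t
      regroup : ∀ a c d e → a + c - (d + e) ≡ a + c - d - e
      regroup = solve-∀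

  module _ (θ-quad≡0 : θ-quad ≡ 0ℤ) (a c d : Fin m) (a≢c : ¬ a ≡ c) (a≢d : ¬ a ≡ d) (c≢d : ¬ c ≡ d) where

    private
      ac cd ad : Fin b
      ac = blockOf a c a≢c
      cd = blockOf c d c≢d
      ad = blockOf a d a≢d

      Anchored : Fin v → Set
      Anchored x = linkEdge x a c ≡ 1ℤ × linkEdge x c d ≡ 0ℤ

      Ordered : Fin v → Fin v → Set
      Ordered x x' = ¬ (linkEdge x a d ≡ 0ℤ × linkEdge x' a d ≡ 1ℤ)

    inside-outside : Fin v → Bool
    inside-outside x = lookup (B ac) x ∧ not (lookup (B cd) x)

    ∑-inside-outside : ∑[ x < v ] 𝟙 (inside-outside x) ≡ K - C
    ∑-inside-outside = begin
      ∑[ x < v ] 𝟙 (inside-outside x)           ≡⟨ sum-cong-≗ (λ x → 𝟙-∧-not (lookup (B ac) x) (lookup (B cd) x)) ⟩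
      ∑[ x < v ] (χ ac x - χ ac x * χ cd x)     ≡⟨ ∑-distrib-- (χ ac) (λ x → χ ac x * χ cd x) ⟩
      ∑[ x < v ] χ ac x - gram ac cd            ≡⟨ cong₂ _-_ (∑-χ ac) (gram-adjacent ac≢cd meet-once) ⟩
      K - C                                     ∎
      where
      𝟙-∧-not : ∀ x y → 𝟙 (x ∧ not y) ≡ 𝟙 x - 𝟙 x * 𝟙 y
      𝟙-∧-not true true = refl
      𝟙-∧-not true false = refl
      𝟙-∧-not false y = refl
      ac≢cd : ¬ ac ≡ cd
      ac≢cd ac≡cd with () ← trans (sym (proj₁ (blockOf-ends a≢c)))
                                  (trans (cong (λ i → lookup (f i) a) ac≡cd) (blockOf-outside c≢d (a≢c ∘ sym) (a≢d ∘ sym)))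
      meet-once : + ∣ f ac ∩ f cd ∣ ≡ 1ℤ
      meet-once = trans (card-∩≡∑ (f ac) (f cd))
        (trans (meet-blockOf ac c≢d)
          (cong₂ (λ x y → 𝟙 x + 𝟙 y) (proj₂ (blockOf-ends a≢c)) (blockOf-outside a≢c a≢d c≢d)))

    anchored : ∀ {x} → inside-outside x ≡ true → Anchored x
    anchored {x} inside with lookup (B ac) x in x∈ac | lookup (B cd) x in x∈cd
    anchored {x} refl | true | false =
      trans (linkEdge-blockOf x a≢c) (cong 𝟙 x∈ac) , trans (linkEdge-blockOf x c≢d) (cong 𝟙 x∈cd)

    ordered-anchored-pair : + 2 ℤ.≤ μ → ∃₂ λ x x' → ¬ x ≡ x' × Anchored x × Anchored x' × Ordered x x'
    ordered-anchored-pair 2≤μ =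
      let x , y , x≢y , x-in , y-in = count≥2⇒two-trues inside-outside (subst (+ 2 ℤ.≤_) μ≡count 2≤μ)
      in order x≢y (anchored x-in) (anchored y-in) (ad-binary x) (ad-binary y)
      where
      μ≡count : μ ≡ ∑[ x < v ] 𝟙 (inside-outside x)
      μ≡count = trans (sym (ℤP.+-identityʳ μ))
                      (trans (cong (λ t → μ + t) (sym θ-quad≡0)) (trans (regroup K A C) (sym ∑-inside-outside)))
        where
        regroup : ∀ K A C → (C - A) + (K + A - C - C) ≡ K - C
        regroup = solve-∀

      ad-binary : ∀ x → Binary (linkEdge x a d)
      ad-binary x = QuadrangleGraph.binary (link θ-quad≡0 x) a≢d

      order : ∀ {x y} → ¬ x ≡ y → Anchored x → Anchored y → Binary (linkEdge x a d) → Binary (linkEdge y a d) →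
              ∃₂ λ x x' → ¬ x ≡ x' × Anchored x × Anchored x' × Ordered x x'
      order x≢y ax ay (inj₂ x-ad) _           = _ , _ , x≢y , ax , ay , λ (x-no-ad , _) → 1≢0 (trans (sym x-ad) x-no-ad)
      order x≢y ax ay (inj₁ _)    (inj₁ y-ad) = _ , _ , x≢y , ax , ay , λ (_ , y-ad′) → 1≢0 (trans (sym y-ad′) y-ad)
      order x≢y ax ay (inj₁ _)    (inj₂ y-ad) = _ , _ , x≢y ∘ sym , ay , ax , λ (y-no-ad , _) → 1≢0 (trans (sym y-ad) y-no-ad)

    module _ {x x' : Fin v} (anc : Anchored x) (anc' : Anchored x') (ordered : Ordered x x') where

      separated-only-by-ad : ∀ i → ¬ ad ≡ i → χ i x * (1ℤ - χ i x') ≡ 0ℤ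
      separated-only-by-ad i ad≢i with block-is-pair i
      ... | p , q , p≢q , refl = by-cases (lookup (B i) x) (lookup (B i) x') refl refl
        where
        is-ad : (p ≡ a × q ≡ d) ⊎ (p ≡ d × q ≡ a) → i ≡ ad
        is-ad (inj₁ (refl , refl)) = refl
        is-ad (inj₂ (refl , refl)) = blockOf-unique i a≢d (proj₂ (blockOf-ends p≢q)) (proj₁ (blockOf-ends p≢q))

        by-cases : ∀ u u' → lookup (B i) x ≡ u → lookup (B i) x' ≡ u' → 𝟙 u * (1ℤ - 𝟙 u') ≡ 0ℤ
        by-cases true false x∈i x'∉i = ⊥-elim (ad≢i (sym (is-ad
          (edge-difference a≢c a≢d c≢d (link θ-quad≡0 x) (link θ-quad≡0 x')
             (proj₁ anc) (proj₂ anc) (proj₁ anc') (proj₂ anc') ordered p≢q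
             (trans (linkEdge-blockOf x p≢q) (cong 𝟙 x∈i)) (trans (linkEdge-blockOf x' p≢q) (cong 𝟙 x'∉i))))))
        by-cases true true _ _ = refl
        by-cases false true _ _ = refl
        by-cases false false _ _ = refl

    replication-gap-binary : + 2 ℤ.≤ μ → ∃ λ x → Binary (r x - Λ)
    replication-gap-binary 2≤μ =
      let x , x' , x≢x' , anc , anc' , ordered = ordered-anchored-pair 2≤μ
          gap≡ad-term = trans (r-Λ≡separating-blocks x≢x') (∑-supported ad _ (separated-only-by-ad anc anc' ordered))
      in x , subst Binary (sym gap≡ad-term) (separation-binary (lookup (B ad) x) (lookup (B ad) x'))
      where
      separation-binary : ∀ u u' → Binary (𝟙 u * (1ℤ - 𝟙 u'))
      separation-binary true true = inj₁ refl
      separation-binary true false = inj₂ refl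
      separation-binary false u' = inj₁ (ℤP.*-zeroˡ (1ℤ - 𝟙 u'))

corollary2p9 : (m : ℕ) → 5 ≤ m →
    ∀ {v b : ℕ} (B : Blocks v b) (k lam l₁ l₂ : ℕ) →
    ¬ (IsQuasiSymmetric B k lam l₁ l₂ × 2 ≤ l₂ ∸ l₁ × BlockGraphIsoTriangular B l₂ m)
corollary2p9 _ 5≤m@(s≤s (s≤s (s≤s (s≤s (s≤s _))))) B k lam l₁ l₂
  ((design , l₁<l₂ , intersections , _ , i , j , _ , Bᵢ∩Bⱼ≡l₂) , 2≤μ , f , f-pair , f-injective , f-onto , f-adjacency) =
  let x , gap-binary = replication-gap-binary θ-quad≡0 0F 1F 2F (λ ()) (λ ()) (λ ()) +2≤μ
  in θ-star-not-binary θ-quad≡0 (subst Binary (gap≡θ-star x) gap-binary)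
  where
  open TriangularDesign B k lam l₁ l₂ design intersections f f-pair f-injective f-onto f-adjacency

  l₂≤k : l₂ ≤ k
  l₂≤k = subst₂ _≤_ Bᵢ∩Bⱼ≡l₂ (proj₁ design i) (∣p∩q∣≤∣p∣ (B i) (B j))

  open Numerology (ℕP.<⇒≤ l₁<l₂) 2≤μ l₂≤k (ℕP.≤-trans (ℕP.n≤1+n 4) 5≤m)

  gap≡θ-star : ∀ x → r x - Λ ≡ θ-star
  gap≡θ-star = replication-gap≡θ-star k≢1 θ-star≢0 0F 1F 2F (λ ()) (λ ()) (λ ())

  θ-quad≡0 : θ-quad ≡ 0ℤ
  θ-quad≡0 = θ-quad-vanishes gap≡θ-star θ-star≢θ-quad 0F 1F 2F 3F (λ ()) (λ ()) (λ ()) (λ ()) (λ ()) (λ ())
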